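{- Let $G$ be a middle-less graph with no $K_{1,1,3}$ minor and no $K_1 \cup K_{2,3}$ minor, and let $S$ be a spanning subgraph of $G$ that is a subdivision of $K_{2,3}$, with terminal vertices $u,v$ and terminal paths $P_1,P_2,P_3$. Suppose that $P_1$ and $P_2$ both have length greater than $2$ and that $G[P_1\cup P_2]$ has an edge $e'=(u',v')$ that is not an edge of $P_1 \cup P_2$. Then either $u'$ and $v'$ are both adjacent to $u$, or $u'$ and $v'$ are both adjacent to $v$.
   Context: A subdivision of a graph is obtained by repeatedly replacing an edge by a path of length 2 through a new vertex. For a subgraph $S$ of $G$ that is a subdivision of $K_{2,3}$, the terminal vertices are the two vertices $u,v$ of degree $3$ in $S$ and the terminal paths are the three $uv$-paths of $S$; $S$ is spanning if it contains all vertices of $G$. The length of a path is its number of edges. $G[H]$ denotes the subgraph of $G$ induced by the vertex set of $H$. An inner vertex of a $uv$-path is a vertex other than $u,v$. Given a set $\mathcal{P}$ of paths in $G$, $P\in\mathcal{P}$ is a middle path if for every other $P'\in\mathcal{P}$ some edge of $G$ joins an inner vertex of $P$ to an inner vertex of $P'$. A graph containing a subdivision of $K_{2,3}$ is middle-less if, for every spanning subgraph that is a subdivision of $K_{2,3}$, none of its terminal paths is a middle path among its three terminal paths. $\cup$ in $K_1\cup K_{2,3}$ denotes disjoint union. -}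

module Defs where

open import Data.Nat using (ℕ; zero; suc; _<_)
open import Data.Fin using (Fin; zero; suc) renaming (_≟_ to _≟ᶠ_)
open import Data.Maybe using (Maybe; just; nothing)
open import Data.List using (List; []; _∷_; _++_; [_]; length)
open import Data.List.Membership.Propositional using (_∈_)
open import Data.List.Relation.Unary.Linked using (Linked)
open import Data.List.Relation.Unary.Unique.Propositional using (Unique)
open import Data.Product using (Σ; ∃; _×_; _,_)
open import Data.Sum using (_⊎_)
open import Relation.Nullary using (¬_; Dec)
open import Relation.Binary.PropositionalEquality using (_≡_; _≢_; refl; sym)

record Graph : Set₁ where
  field
    n      : ℕ
    Adj    : Fin n → Fin n → Set
    adj-sym : ∀ {x y} → Adj x y → Adj y x
    adj-irrefl : ∀ {x} → ¬ Adj x x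
    adj-dec : ∀ x y → Dec (Adj x y)

  V : Set
  V = Fin n

open Graph public

data Consec {A : Set} : List A → A → A → Set where
  here  : ∀ {x y xs} → Consec (x ∷ y ∷ xs) x y
  there : ∀ {x a b xs} → Consec xs a b → Consec (x ∷ xs) a b

PathEdge : {A : Set} → List A → A → A → Set
PathEdge xs a b = Consec xs a b ⊎ Consec xs b a

-- Terminal vertices u ≠ v; terminal path i has vertex sequence
--   u ∷ P i ++ [ v ]   (P i = list of inner vertices, nonempty since
-- K_{2,3} has no uv-edge, so each terminal path has length ≥ 2).

Three : Set
Three = Fin 3

record K23Sub (G : Graph) : Set where
  field
    u v      : V G
    u≢v      : u ≢ v
    P        : Three → List (V G)
    inner≠[] : ∀ i → P i ≢ []
    isPath   : ∀ i → Linked (Adj G) (u ∷ P i ++ [ v ]) × Unique (u ∷ P i ++ [ v ])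
    disjoint : ∀ i j → i ≢ j → ∀ w → w ∈ P i → ¬ (w ∈ P j)

  path : Three → List (V G)
  path i = u ∷ P i ++ [ v ]

  pathLength : Three → ℕ
  pathLength i = suc (length (P i))

open K23Sub public

Spanning : {G : Graph} → K23Sub G → Set
Spanning {G} S = ∀ (w : V G) → w ≡ u S ⊎ w ≡ v S ⊎ Σ Three (λ i → w ∈ P S i)

Middle : {G : Graph} → K23Sub G → Three → Set
Middle {G} S i = ∀ j → j ≢ i →
  Σ (V G) λ a → Σ (V G) λ b → a ∈ P S i × b ∈ P S j × Adj G a b

MiddleLess : Graph → Set
MiddleLess G = K23Sub G × (∀ (S : K23Sub G) → Spanning S → ∀ i → ¬ Middle S i)

data ReachIn (G : Graph) (Q : V G → Set) : V G → V G → Set where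
  stay : ∀ {x} → ReachIn G Q x x
  step : ∀ {x y z} → Adj G x y → Q y → ReachIn G Q y z → ReachIn G Q x z

-- H is a minor of G: a map assigning vertices of G to branch sets
-- (nothing = deleted), branch sets nonempty and connected, and each edge
-- of H realised by an edge of G between the corresponding branch sets.
HasMinor : Graph → Graph → Set
HasMinor G H = Σ (V G → Maybe (V H)) λ f →
    (∀ i → Σ (V G) λ x → f x ≡ just i)
  × (∀ i x y → f x ≡ just i → f y ≡ just i → ReachIn G (λ z → f z ≡ just i) x y)
  × (∀ i j → Adj H i j → Σ (V G) λ x → Σ (V G) λ y →
        f x ≡ just i × f y ≡ just j × Adj G x y)

part113 : Fin 5 → Fin 3
part113 zero = zero
part113 (suc zero) = suc zero
part113 (suc (suc _)) = suc (suc zero)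

K113 : Graph
K113 = record
  { n = 5
  ; Adj = λ x y → part113 x ≢ part113 y
  ; adj-sym = λ p q → p (sym q)
  ; adj-irrefl = λ p → p refl
  ; adj-dec = λ x y → ¬? (part113 x ≟ᶠ part113 y)
  }
  where open import Relation.Nullary using (¬?)

part123 : Fin 6 → Fin 3
part123 zero = zero
part123 (suc zero) = suc zero
part123 (suc (suc zero)) = suc zero
part123 (suc (suc (suc _))) = suc (suc zero)

AdjK1K23 : Fin 6 → Fin 6 → Set
AdjK1K23 x y = part123 x ≢ zero × part123 y ≢ zero × part123 x ≢ part123 y

K1∪K23 : Graph
K1∪K23 = record
  { n = 6
  ; Adj = AdjK1K23
  ; adj-sym = λ { (a , b , c) → b , a , λ q → c (sym q) }
  ; adj-irrefl = λ { (_ , _ , c) → c refl }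
  ; adj-dec = λ x y → (¬? (part123 x ≟ᶠ zero)) ×-dec ((¬? (part123 y ≟ᶠ zero)) ×-dec (¬? (part123 x ≟ᶠ part123 y)))
  }
  where open import Relation.Nullary using (¬?; _×-dec_)

-- An edge of G[P₁ ∪ P₂] off the two paths yields a K₁,₁,₃ minor unless its ends
-- are neighbours of the same terminal. Such a minor is given by two connected
-- "apex" sets joined by an edge together with three disjoint "ears", each a path
-- running from the first apex set to the second. For a chord pq of a terminal
-- path the apexes are the two pieces of that path beyond p and beyond q, and the
-- ears are the segment between p and q and the other two terminal paths. For an
-- edge xy from the inside of Pᵢ to the inside of Pⱼ the apexes are the u–x part of
-- Pᵢ and the y–v part of Pⱼ, and the ears are the rest of Pᵢ, the rest of Pⱼ and
-- the third terminal path; this works as soon as x is not next to v on Pᵢ and y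
-- is not next to u on Pⱼ, or symmetrically.
module Submission where

open import Defs
open import Data.Nat as ℕ using (_<_)
open import Data.Nat.Properties using (<-irrefl)
open import Data.Fin using (Fin; zero; suc) renaming (_≟_ to _≟ᶠ_)
open import Data.Fin.Properties using (any?)
open import Data.Maybe using (Maybe; just; nothing)
open import Data.Maybe.Properties using (just-injective)
open import Data.List using (List; []; _∷_; _++_; [_]; length; concatMap; allFin)
open import Data.List.Properties using (++-assoc; ++-identityʳ; ∷-injectiveʳ)
open import Data.List.Membership.Propositional using (_∈_; _∉_)
open import Data.List.Membership.Propositional.Properties
  using (∈-++⁺ˡ; ∈-++⁺ʳ; ∈-++⁻; ∈-∃++; ∈-concat⁺′; ∈-map⁺; ∈-allFin)
open import Data.List.Relation.Unary.Any using (here; there)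
open import Data.List.Relation.Unary.All as All using ()
open import Data.List.Relation.Unary.All.Properties using (++⁻ˡ; ++⁻ʳ)
open import Data.List.Relation.Unary.AllPairs using ([]; _∷_)
open import Data.List.Relation.Unary.Linked as Linked using (Linked; []; [-]; _∷_)
open import Data.List.Relation.Unary.Unique.Propositional using (Unique)
open import Data.List.Relation.Unary.Unique.Propositional.Properties
  using (++⁺; Unique[x∷xs]⇒x∉xs)
open import Data.List.Relation.Binary.Disjoint.Propositional using (Disjoint)
open import Data.Product using (∃; ∃₂; _×_; _,_; proj₁; proj₂)
open import Data.Sum using (_⊎_; inj₁; inj₂; swap; [_,_]′)
open import Data.Empty using (⊥-elim)
open import Function using (_∘_)
open import Relation.Nullary using (¬_; yes; no)
open import Relation.Binary.PropositionalEquality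
  using (_≡_; _≢_; refl; sym; trans; cong; subst; subst₂; ≢-sym; setoid)

module _ {A : Set} where

  Unique-++⁻ : ∀ (xs : List A) {ys} → Unique (xs ++ ys) → Unique xs × Unique ys × Disjoint xs ys
  Unique-++⁻ []       u = [] , u , λ { (() , _) }
  Unique-++⁻ (x ∷ xs) (x∉ ∷ u) with Unique-++⁻ xs u
  ... | u-xs , u-ys , xs#ys = ++⁻ˡ xs x∉ ∷ u-xs , u-ys , λ
    { (here refl , z∈ys)  → All.lookup (++⁻ʳ xs x∉) z∈ys refl
    ; (there z∈xs , z∈ys) → xs#ys (z∈xs , z∈ys) }

  Unique-concatMap⇒Disjoint : ∀ {B : Set} (L : B → List A) {ks i j} →
    Unique (concatMap L ks) → i ∈ ks → j ∈ ks → i ≢ j → Disjoint (L i) (L j)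
  Unique-concatMap⇒Disjoint L u (here refl) (here refl) i≢j = ⊥-elim (i≢j refl)
  Unique-concatMap⇒Disjoint L {k ∷ _} u (here refl) (there j∈) _ (z∈Li , z∈Lj) =
    proj₂ (proj₂ (Unique-++⁻ (L k) u)) (z∈Li , ∈-concat⁺′ z∈Lj (∈-map⁺ L j∈))
  Unique-concatMap⇒Disjoint L {k ∷ _} u (there i∈) (here refl) _ (z∈Li , z∈Lj) =
    proj₂ (proj₂ (Unique-++⁻ (L k) u)) (z∈Lj , ∈-concat⁺′ z∈Li (∈-map⁺ L i∈))
  Unique-concatMap⇒Disjoint L {k ∷ _} u (there i∈) (there j∈) i≢j =
    Unique-concatMap⇒Disjoint L (proj₁ (proj₂ (Unique-++⁻ (L k) u))) i∈ j∈ i≢j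

  data Separated (xs : List A) (x y : A) : Set where
    separated : ∀ as bs cs → xs ≡ as ++ x ∷ bs ++ y ∷ cs → Separated xs x y

  ∈-∈⇒Separated : ∀ {x y xs} → x ∈ xs → y ∈ xs → x ≢ y → Separated xs x y ⊎ Separated xs y x
  ∈-∈⇒Separated (here refl) (here refl) x≢y = ⊥-elim (x≢y refl)
  ∈-∈⇒Separated (here refl) (there y∈) _ with ∈-∃++ y∈
  ... | bs , cs , refl = inj₁ (separated [] bs cs refl)
  ∈-∈⇒Separated (there x∈) (here refl) _ with ∈-∃++ x∈
  ... | bs , cs , refl = inj₂ (separated [] bs cs refl)
  ∈-∈⇒Separated {xs = z ∷ _} (there x∈) (there y∈) x≢y with ∈-∈⇒Separated x∈ y∈ x≢y
  ... | inj₁ (separated as bs cs refl) = inj₁ (separated (z ∷ as) bs cs refl)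
  ... | inj₂ (separated as bs cs refl) = inj₂ (separated (z ∷ as) bs cs refl)

  Consec-++ : ∀ as {x y : A} {ys} → Consec (as ++ x ∷ y ∷ ys) x y
  Consec-++ []       = here
  Consec-++ (_ ∷ as) = there (Consec-++ as)

  ∷≡++⇒∈ : ∀ as {x y : A} {xs ys} → x ∷ xs ≡ as ++ y ∷ ys → x ∈ as ++ [ y ]
  ∷≡++⇒∈ []      refl = here refl
  ∷≡++⇒∈ (_ ∷ _) refl = here refl

  ++[]≡++⇒∈ : ∀ xs as {x y : A} {ys} → xs ++ [ x ] ≡ as ++ y ∷ ys → x ∈ y ∷ ys
  ++[]≡++⇒∈ []       []           refl = here refl
  ++[]≡++⇒∈ []       (_ ∷ [])     ()
  ++[]≡++⇒∈ []       (_ ∷ _ ∷ _)  ()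
  ++[]≡++⇒∈ (_ ∷ xs) []           refl = there (∈-++⁺ʳ xs (here refl))
  ++[]≡++⇒∈ (_ ∷ xs) (_ ∷ as)     eq = ++[]≡++⇒∈ xs as (∷-injectiveʳ eq)

  module _ {R : A → A → Set} where

    Linked-++⁻ˡ : ∀ xs {ys} → Linked R (xs ++ ys) → Linked R xs
    Linked-++⁻ˡ []           _       = []
    Linked-++⁻ˡ (_ ∷ [])     _       = [-]
    Linked-++⁻ˡ (_ ∷ y ∷ xs) (r ∷ l) = r ∷ Linked-++⁻ˡ (y ∷ xs) l

    Linked-++⁻ʳ : ∀ xs {ys} → Linked R (xs ++ ys) → Linked R ys
    Linked-++⁻ʳ []       l = l
    Linked-++⁻ʳ (_ ∷ xs) l = Linked-++⁻ʳ xs (Linked.tail l)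

    Linked-split : ∀ xs {y ys} → Linked R (xs ++ y ∷ ys) → Linked R (xs ++ [ y ]) × Linked R (y ∷ ys)
    Linked-split xs {y} {ys} l =
      Linked-++⁻ˡ (xs ++ [ y ]) (subst (Linked R) (sym (++-assoc xs [ y ] ys)) l) , Linked-++⁻ʳ xs l

    Linked-last : ∀ xs {y} → xs ≢ [] → Linked R (xs ++ [ y ]) → ∃ λ x → x ∈ xs × R x y
    Linked-last []           xs≢[] _          = ⊥-elim (xs≢[] refl)
    Linked-last (x ∷ [])     _     (r ∷ [-])  = x , here refl , r
    Linked-last (_ ∷ x ∷ xs) _     (_ ∷ l) with Linked-last (x ∷ xs) (λ ()) l
    ... | z , z∈ , r = z , there z∈ , r

module _ (G : Graph) where

  ReachIn-map : ∀ {Q Q′ : V G → Set} {x y} → (∀ {z} → Q z → Q′ z) →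
    ReachIn G Q x y → ReachIn G Q′ x y
  ReachIn-map f stay           = stay
  ReachIn-map f (step xy q r)  = step xy (f q) (ReachIn-map f r)

  ReachIn-trans : ∀ {Q x y z} → ReachIn G Q x y → ReachIn G Q y z → ReachIn G Q x z
  ReachIn-trans stay          r′ = r′
  ReachIn-trans (step xy q r) r′ = step xy q (ReachIn-trans r r′)

  Connected : List (V G) → Set
  Connected L = ∀ {x y} → x ∈ L → y ∈ L → ReachIn G (_∈ L) x y

  Joined : List (V G) → List (V G) → Set
  Joined A B = ∃₂ λ x y → x ∈ A × y ∈ B × Adj G x y

  Joined-sym : ∀ {A B} → Joined A B → Joined B A
  Joined-sym (x , y , x∈ , y∈ , xy) = y , x , y∈ , x∈ , adj-sym G xy

  Linked⇒Connected : ∀ {L} → Linked (Adj G) L → Connected L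
  Linked⇒Connected [-]     (here refl) (here refl) = stay
  Linked⇒Connected [-]     (here refl) (there ())
  Linked⇒Connected [-]     (there ())  _
  Linked⇒Connected (_ ∷ _) (here refl) (here refl) = stay
  Linked⇒Connected (r ∷ l) (here refl) (there y∈)  =
    step r (there (here refl)) (ReachIn-map there (Linked⇒Connected l (here refl) y∈))
  Linked⇒Connected (r ∷ l) (there x∈)  (here refl) =
    ReachIn-trans (ReachIn-map there (Linked⇒Connected l x∈ (here refl)))
                  (step (adj-sym G r) (here refl) stay)
  Linked⇒Connected (r ∷ l) (there x∈)  (there y∈)  = ReachIn-map there (Linked⇒Connected l x∈ y∈)

  branchSets⇒HasMinor : (H : Graph) (L : V H → List (V G)) →
    (∀ i → ∃ (_∈ L i)) → (∀ i → Connected (L i)) → Unique (concatMap L (allFin (n H))) →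
    (∀ {i j} → Adj H i j → Joined (L i) (L j)) → HasMinor G H
  branchSets⇒HasMinor H L inhabited connected unique joined =
    f , (λ i → let x , x∈ = inhabited i in x , f-complete x∈)
      , (λ i x y fx fy → ReachIn-map f-complete (connected i (f-sound fx) (f-sound fy)))
      , (λ i j ij → let x , y , x∈ , y∈ , xy = joined ij
                    in x , y , f-complete x∈ , f-complete y∈ , xy)
    where
    open import Data.List.Membership.DecPropositional (_≟ᶠ_ {n G}) using (_∈?_)

    same-branch : ∀ {x i j} → x ∈ L i → x ∈ L j → i ≡ j
    same-branch {i = i} {j} x∈i x∈j with i ≟ᶠ j
    ... | yes i≡j = i≡j
    ... | no i≢j  =
      ⊥-elim (Unique-concatMap⇒Disjoint L unique (∈-allFin i) (∈-allFin j) i≢j (x∈i , x∈j))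

    f : V G → Maybe (V H)
    f x with any? (λ i → x ∈? L i)
    ... | yes (i , _) = just i
    ... | no _        = nothing

    f-complete : ∀ {x i} → x ∈ L i → f x ≡ just i
    f-complete {x} x∈ with any? (λ i → x ∈? L i)
    ... | yes (_ , x∈′) = cong just (same-branch x∈′ x∈)
    ... | no ∄          = ⊥-elim (∄ (_ , x∈))

    f-sound : ∀ {x i} → f x ≡ just i → x ∈ L i
    f-sound {x} fx≡ with any? (λ i → x ∈? L i)
    f-sound {x} fx≡ | yes (_ , x∈) = subst (λ i → x ∈ L i) (just-injective fx≡) x∈
    f-sound     ()  | no _

  data Ear (A B C : List (V G)) : Set where
    ear : ∀ {a b} → a ∈ A → b ∈ B → C ≢ [] → Linked (Adj G) (a ∷ C ++ [ b ]) → Ear A B C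

  Ear⇒Linked : ∀ {A B C} → Ear A B C → Linked (Adj G) C
  Ear⇒Linked {C = C} (ear _ _ _ l) = Linked-++⁻ˡ C (Linked.tail l)

  Ear⇒Joinedˡ : ∀ {A B C} → Ear A B C → Joined A C
  Ear⇒Joinedˡ {C = []}    (ear _  _ C≢[] _)       = ⊥-elim (C≢[] refl)
  Ear⇒Joinedˡ {C = c ∷ _} (ear a∈ _ _    (r ∷ _)) = _ , c , a∈ , here refl , r

  Ear⇒Joinedʳ : ∀ {A B C} → Ear A B C → Joined C B
  Ear⇒Joinedʳ {C = C} (ear _ b∈ C≢[] l) =
    let x , x∈ , r = Linked-last C C≢[] (Linked.tail l) in x , _ , x∈ , b∈ , r

  apexesAndEars⇒K113 : ∀ {A B C₀ C₁ C₂} → Linked (Adj G) A → Linked (Adj G) B → Joined A B →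
    Ear A B C₀ → Ear A B C₁ → Ear A B C₂ → Unique (A ++ B ++ C₀ ++ C₁ ++ C₂) → HasMinor G K113
  apexesAndEars⇒K113 {A} {B} {C₀} {C₁} {C₂} A-linked B-linked A~B E₀ E₁ E₂ unique =
    branchSets⇒HasMinor K113 L inhabited connected unique′ joined
    where
    L : Fin 5 → List (V G)
    L zero                      = A
    L (suc zero)                = B
    L (suc (suc zero))          = C₀
    L (suc (suc (suc zero)))    = C₁
    L (suc (suc (suc (suc _)))) = C₂

    ears : ∀ c → Ear A B (L (suc (suc c)))
    ears zero             = E₀
    ears (suc zero)       = E₁
    ears (suc (suc zero)) = E₂

    inhabited : ∀ i → ∃ (_∈ L i)
    inhabited zero          = let x , _ , x∈ , _ = A~B in x , x∈
    inhabited (suc zero)    = let _ , y , _ , y∈ , _ = A~B in y , y∈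
    inhabited (suc (suc c)) = let _ , y , _ , y∈ , _ = Ear⇒Joinedˡ (ears c) in y , y∈

    connected : ∀ i → Connected (L i)
    connected zero          = Linked⇒Connected A-linked
    connected (suc zero)    = Linked⇒Connected B-linked
    connected (suc (suc c)) = Linked⇒Connected (Ear⇒Linked (ears c))

    unique′ : Unique (concatMap L (allFin 5))
    unique′ = subst Unique (cong (λ t → A ++ B ++ C₀ ++ C₁ ++ t) (sym (++-identityʳ C₂))) unique

    joined : ∀ {i j} → Adj K113 i j → Joined (L i) (L j)
    joined {zero}          {zero}          ne = ⊥-elim (ne refl)
    joined {zero}          {suc zero}      _  = A~B
    joined {zero}          {suc (suc c)}   _  = Ear⇒Joinedˡ (ears c)
    joined {suc zero}      {zero}          _  = Joined-sym A~B
    joined {suc zero}      {suc zero}      ne = ⊥-elim (ne refl)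
    joined {suc zero}      {suc (suc c)}   _  = Joined-sym (Ear⇒Joinedʳ (ears c))
    joined {suc (suc c)}   {zero}          _  = Joined-sym (Ear⇒Joinedˡ (ears c))
    joined {suc (suc c)}   {suc zero}      _  = Ear⇒Joinedʳ (ears c)
    joined {suc (suc _)}   {suc (suc _)}   ne = ⊥-elim (ne refl)

module _ {G : Graph} (S : K23Sub G) where

  open import Data.List.Relation.Binary.Permutation.Setoid (setoid (V G)) using (↭-refl)
  open import Data.List.Relation.Binary.Permutation.Setoid.Properties (setoid (V G))
    using (++-commutativeMonoid; Unique-resp-↭)
  open import Algebra.Solver.CommutativeMonoid ++-commutativeMonoid using (solve; _⊕_; _⊜_)

  AdjacentToSameTerminal : V G → V G → Set
  AdjacentToSameTerminal x y = (Adj G x (u S) × Adj G y (u S)) ⊎ (Adj G x (v S) × Adj G y (v S))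

  path-linked : ∀ i → Linked (Adj G) (path S i)
  path-linked i = proj₁ (isPath S i)

  path-unique : ∀ i → Unique (path S i)
  path-unique i = proj₂ (isPath S i)

  inner-unique : ∀ i → Unique (P S i ++ [ v S ])
  inner-unique i with path-unique i
  ... | _ ∷ rest = rest

  u∉inner : ∀ i → u S ∉ P S i
  u∉inner i u∈ = Unique[x∷xs]⇒x∉xs (path-unique i) (∈-++⁺ˡ u∈)

  v∉inner : ∀ i → v S ∉ P S i
  v∉inner i v∈ = proj₂ (proj₂ (Unique-++⁻ (P S i) (inner-unique i))) (v∈ , here refl)

  ∈-path⁻ : ∀ i {w} → w ∈ path S i → w ∈ P S i ⊎ (∀ j → w ∈ path S j)
  ∈-path⁻ i (here refl) = inj₂ λ _ → here refl
  ∈-path⁻ i (there w∈) with ∈-++⁻ (P S i) w∈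
  ... | inj₁ w∈i        = inj₁ w∈i
  ... | inj₂ (here refl) = inj₂ λ j → ∈-++⁺ʳ (u S ∷ P S j) (here refl)

  path-inner-disjoint : ∀ {i j} → i ≢ j → Disjoint (path S i) (P S j)
  path-inner-disjoint {j = j} _ (here refl , w∈j) = u∉inner j w∈j
  path-inner-disjoint {i} {j} i≢j (there w∈ , w∈j) with ∈-++⁻ (P S i) w∈
  ... | inj₁ w∈i        = disjoint S i j i≢j _ w∈i w∈j
  ... | inj₂ (here refl) = v∉inner j w∈j

  path-inner-inner-unique : ∀ {i j k} → i ≢ j → i ≢ k → j ≢ k → Unique (path S i ++ P S j ++ P S k)
  path-inner-inner-unique {i} {j} {k} i≢j i≢k j≢k =
    ++⁺ (path-unique i) (++⁺ (inner j) (inner k) λ (w∈j , w∈k) → disjoint S j k j≢k _ w∈j w∈k)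
      λ (w∈i , w∈jk) → [ (λ w∈j → path-inner-disjoint i≢j (w∈i , w∈j))
                       , (λ w∈k → path-inner-disjoint i≢k (w∈i , w∈k)) ]′ (∈-++⁻ (P S j) w∈jk)
    where
    inner : ∀ l → Unique (P S l)
    inner l = proj₁ (Unique-++⁻ (P S l) (inner-unique l))

  inner-split⇒Linked : ∀ {i} X₁ {x X₂} → P S i ≡ X₁ ++ x ∷ X₂ →
    Linked (Adj G) (u S ∷ X₁ ++ [ x ]) × Linked (Adj G) (x ∷ X₂ ++ [ v S ])
  inner-split⇒Linked {i} X₁ {x} {X₂} P≡ =
    Linked-split (u S ∷ X₁) (subst (Linked (Adj G)) path≡ (path-linked i))
    where
    path≡ : path S i ≡ u S ∷ X₁ ++ x ∷ X₂ ++ [ v S ]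
    path≡ = trans (cong (λ xs → u S ∷ xs ++ [ v S ]) P≡)
                  (cong (u S ∷_) (++-assoc X₁ (x ∷ X₂) [ v S ]))

  one-inner⇒¬2<pathLength : ∀ {i x} → P S i ≡ [ x ] → ¬ 2 < pathLength S i
  one-inner⇒¬2<pathLength {i} P≡ 2< = <-irrefl refl (subst (λ xs → 2 < ℕ.suc (length xs)) P≡ 2<)

  separated⇒K113 : ∀ {i j k p q as bs cs} → i ≢ j → i ≢ k → j ≢ k →
    path S i ≡ as ++ p ∷ bs ++ q ∷ cs → bs ≢ [] → Adj G p q → HasMinor G K113
  separated⇒K113 {i} {j} {k} {p} {q} {as} {bs} {cs} i≢j i≢k j≢k path≡ bs≢[] pq =
    apexesAndEars⇒K113 G before after (p , q , p∈ , here refl , pq)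
      (ear p∈ (here refl) bs≢[] between) (ear u∈ v∈ (inner≠[] S j) (path-linked j))
      (ear u∈ v∈ (inner≠[] S k) (path-linked k)) unique
    where
    before : Linked (Adj G) (as ++ [ p ])
    before = proj₁ (Linked-split as (subst (Linked (Adj G)) path≡ (path-linked i)))
    from-p : Linked (Adj G) (p ∷ bs ++ q ∷ cs)
    from-p = proj₂ (Linked-split as (subst (Linked (Adj G)) path≡ (path-linked i)))
    between : Linked (Adj G) (p ∷ bs ++ [ q ])
    between = proj₁ (Linked-split (p ∷ bs) from-p)
    after : Linked (Adj G) (q ∷ cs)
    after = proj₂ (Linked-split (p ∷ bs) from-p)
    p∈ : p ∈ as ++ [ p ]
    p∈ = ∈-++⁺ʳ as (here refl)
    u∈ : u S ∈ as ++ [ p ]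
    u∈ = ∷≡++⇒∈ as path≡
    v∈ : v S ∈ q ∷ cs
    v∈ = ++[]≡++⇒∈ (u S ∷ P S i) (as ++ p ∷ bs) (trans path≡ (sym (++-assoc as (p ∷ bs) (q ∷ cs))))
    unique : Unique ((as ++ [ p ]) ++ (q ∷ cs) ++ bs ++ P S j ++ P S k)
    unique = Unique-resp-↭
      (solve 7 (λ as p bs q cs Pj Pk →
          (as ⊕ p ⊕ bs ⊕ q ⊕ cs) ⊕ Pj ⊕ Pk ⊜ (as ⊕ p) ⊕ (q ⊕ cs) ⊕ bs ⊕ Pj ⊕ Pk)
        ↭-refl as [ p ] bs [ q ] cs (P S j) (P S k))
      (subst (λ xs → Unique (xs ++ P S j ++ P S k)) path≡ (path-inner-inner-unique i≢j i≢k j≢k))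

  chord⇒K113 : ∀ i j k {x y} → i ≢ j → i ≢ k → j ≢ k → x ∈ path S i → y ∈ path S i →
    Adj G x y → ¬ PathEdge (path S i) x y → HasMinor G K113
  chord⇒K113 i j k i≢j i≢k j≢k x∈ y∈ xy ¬edge
    with ∈-∈⇒Separated x∈ y∈ (λ { refl → adj-irrefl G xy })
  ... | inj₁ (separated as [] cs path≡) =
    ⊥-elim (¬edge (inj₁ (subst (λ xs → Consec xs _ _) (sym path≡) (Consec-++ as))))
  ... | inj₁ (separated as bs@(_ ∷ _) cs path≡) =
    separated⇒K113 {bs = bs} {cs} i≢j i≢k j≢k path≡ (λ ()) xy
  ... | inj₂ (separated as [] cs path≡) =
    ⊥-elim (¬edge (inj₂ (subst (λ xs → Consec xs _ _) (sym path≡) (Consec-++ as))))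
  ... | inj₂ (separated as bs@(_ ∷ _) cs path≡) =
    separated⇒K113 {bs = bs} {cs} i≢j i≢k j≢k path≡ (λ ()) (adj-sym G xy)

  crossing⇒K113 : ∀ {i j k X₁ x X₂ Y₁ y Y₂} → i ≢ j → i ≢ k → j ≢ k →
    P S i ≡ X₁ ++ x ∷ X₂ → P S j ≡ Y₁ ++ y ∷ Y₂ → X₂ ≢ [] → Y₁ ≢ [] → Adj G x y →
    HasMinor G K113
  crossing⇒K113 {i} {j} {k} {X₁} {x} {X₂} {Y₁} {y} {Y₂} i≢j i≢k j≢k Pi≡ Pj≡ X₂≢[] Y₁≢[] xy =
    apexesAndEars⇒K113 G u-to-x y-to-v (x , y , x∈ , here refl , xy)
      (ear x∈ v∈ X₂≢[] x-to-v) (ear (here refl) (here refl) Y₁≢[] u-to-y)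
      (ear (here refl) v∈ (inner≠[] S k) (path-linked k)) unique
    where
    u-to-x : Linked (Adj G) (u S ∷ X₁ ++ [ x ])
    u-to-x = proj₁ (inner-split⇒Linked X₁ Pi≡)
    x-to-v : Linked (Adj G) (x ∷ X₂ ++ [ v S ])
    x-to-v = proj₂ (inner-split⇒Linked X₁ Pi≡)
    u-to-y : Linked (Adj G) (u S ∷ Y₁ ++ [ y ])
    u-to-y = proj₁ (inner-split⇒Linked Y₁ Pj≡)
    y-to-v : Linked (Adj G) (y ∷ Y₂ ++ [ v S ])
    y-to-v = proj₂ (inner-split⇒Linked Y₁ Pj≡)
    x∈ : x ∈ u S ∷ X₁ ++ [ x ]
    x∈ = ∈-++⁺ʳ (u S ∷ X₁) (here refl)
    v∈ : v S ∈ y ∷ Y₂ ++ [ v S ]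
    v∈ = ∈-++⁺ʳ (y ∷ Y₂) (here refl)
    unique : Unique ((u S ∷ X₁ ++ [ x ]) ++ (y ∷ Y₂ ++ [ v S ]) ++ X₂ ++ Y₁ ++ P S k)
    unique = Unique-resp-↭
      (solve 9 (λ u X₁ x X₂ v Y₁ y Y₂ Pk →
          (u ⊕ (X₁ ⊕ x ⊕ X₂) ⊕ v) ⊕ (Y₁ ⊕ y ⊕ Y₂) ⊕ Pk
            ⊜ (u ⊕ X₁ ⊕ x) ⊕ (y ⊕ Y₂ ⊕ v) ⊕ X₂ ⊕ Y₁ ⊕ Pk)
        ↭-refl [ u S ] X₁ [ x ] X₂ [ v S ] Y₁ [ y ] Y₂ (P S k))
      (subst₂ (λ Pi Pj → Unique ((u S ∷ Pi ++ [ v S ]) ++ Pj ++ P S k)) Pi≡ Pj≡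
        (path-inner-inner-unique i≢j i≢k j≢k))

  inner-edge⇒AdjacentToSameTerminal : ∀ {i j k x y} → ¬ HasMinor G K113 → i ≢ j → i ≢ k → j ≢ k →
    2 < pathLength S i → 2 < pathLength S j → x ∈ P S i → y ∈ P S j → Adj G x y →
    AdjacentToSameTerminal x y
  inner-edge⇒AdjacentToSameTerminal {i} {j} {k} {x} {y} no-K113 i≢j i≢k j≢k 2<i 2<j x∈ y∈ xy =
    let X₁ , X₂ , Pi≡ = ∈-∃++ x∈
        Y₁ , Y₂ , Pj≡ = ∈-∃++ y∈
    in cases X₁ X₂ Y₁ Y₂ Pi≡ Pj≡
    where
    cases : ∀ X₁ X₂ Y₁ Y₂ → P S i ≡ X₁ ++ x ∷ X₂ → P S j ≡ Y₁ ++ y ∷ Y₂ →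
      AdjacentToSameTerminal x y
    cases X₁ X₂@(_ ∷ _) Y₁@(_ ∷ _) Y₂ Pi≡ Pj≡ =
      ⊥-elim (no-K113 (crossing⇒K113 {X₁ = X₁} {X₂ = X₂} {Y₁ = Y₁} {Y₂ = Y₂} i≢j i≢k j≢k Pi≡ Pj≡
        (λ ()) (λ ()) xy))
    cases X₁@(_ ∷ _) X₂ Y₁ Y₂@(_ ∷ _) Pi≡ Pj≡ =
      ⊥-elim (no-K113 (crossing⇒K113 {X₁ = Y₁} {X₂ = Y₂} {Y₁ = X₁} {Y₂ = X₂} (≢-sym i≢j) j≢k i≢k Pj≡ Pi≡
        (λ ()) (λ ()) (adj-sym G xy)))
    cases [] [] _ _ Pi≡ _ = ⊥-elim (one-inner⇒¬2<pathLength Pi≡ 2<i)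
    cases _ _ [] [] _ Pj≡ = ⊥-elim (one-inner⇒¬2<pathLength Pj≡ 2<j)
    cases [] (_ ∷ _) [] (_ ∷ _) Pi≡ Pj≡ =
      inj₁ ( adj-sym G (Linked.head (proj₁ (inner-split⇒Linked [] Pi≡)))
           , adj-sym G (Linked.head (proj₁ (inner-split⇒Linked [] Pj≡))))
    cases X₁@(_ ∷ _) [] Y₁@(_ ∷ _) [] Pi≡ Pj≡ =
      inj₂ ( Linked.head (proj₂ (inner-split⇒Linked X₁ Pi≡))
           , Linked.head (proj₂ (inner-split⇒Linked Y₁ Pj≡)))

  cross-edge⇒AdjacentToSameTerminal : ∀ i j k {x y} → ¬ HasMinor G K113 → i ≢ j → i ≢ k → j ≢ k →
    2 < pathLength S i → 2 < pathLength S j → x ∈ path S i → y ∈ path S j → Adj G x y →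
    ¬ (PathEdge (path S i) x y ⊎ PathEdge (path S j) x y) → AdjacentToSameTerminal x y
  cross-edge⇒AdjacentToSameTerminal i j k no-K113 i≢j i≢k j≢k 2<i 2<j x∈ y∈ xy ¬edge
    with ∈-path⁻ i x∈ | ∈-path⁻ j y∈
  ... | inj₂ x∈all | _ =
    ⊥-elim (no-K113 (chord⇒K113 j i k (≢-sym i≢j) j≢k i≢k (x∈all j) y∈ xy (¬edge ∘ inj₂)))
  ... | _ | inj₂ y∈all =
    ⊥-elim (no-K113 (chord⇒K113 i j k i≢j i≢k j≢k x∈ (y∈all i) xy (¬edge ∘ inj₁)))
  ... | inj₁ x∈Pi | inj₁ y∈Pj =
    inner-edge⇒AdjacentToSameTerminal no-K113 i≢j i≢k j≢k 2<i 2<j x∈Pi y∈Pj xy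

lemma4 : (G : Graph) → MiddleLess G → ¬ HasMinor G K113 → ¬ HasMinor G K1∪K23 →
    (S : K23Sub G) → Spanning S →
    2 < pathLength S zero → 2 < pathLength S (suc zero) →
    ∀ u' v' → u' ∈ path S zero ++ path S (suc zero) → v' ∈ path S zero ++ path S (suc zero) →
    Adj G u' v' → ¬ (PathEdge (path S zero) u' v' ⊎ PathEdge (path S (suc zero)) u' v') →
    (Adj G u' (u S) × Adj G v' (u S)) ⊎ (Adj G u' (v S) × Adj G v' (v S))
lemma4 G _ no-K113 _ S _ 2<₀ 2<₁ u' v' u'∈ v'∈ u'v' ¬edge
  with ∈-++⁻ (path S zero) u'∈ | ∈-++⁻ (path S zero) v'∈
... | inj₁ u'∈₀ | inj₁ v'∈₀ =
  ⊥-elim (no-K113 (chord⇒K113 S zero (suc zero) (suc (suc zero)) (λ ()) (λ ()) (λ ())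
    u'∈₀ v'∈₀ u'v' (¬edge ∘ inj₁)))
... | inj₂ u'∈₁ | inj₂ v'∈₁ =
  ⊥-elim (no-K113 (chord⇒K113 S (suc zero) zero (suc (suc zero)) (λ ()) (λ ()) (λ ())
    u'∈₁ v'∈₁ u'v' (¬edge ∘ inj₂)))
... | inj₁ u'∈₀ | inj₂ v'∈₁ =
  cross-edge⇒AdjacentToSameTerminal S zero (suc zero) (suc (suc zero)) no-K113 (λ ()) (λ ()) (λ ())
    2<₀ 2<₁ u'∈₀ v'∈₁ u'v' ¬edge
... | inj₂ u'∈₁ | inj₁ v'∈₀ =
  cross-edge⇒AdjacentToSameTerminal S (suc zero) zero (suc (suc zero)) no-K113 (λ ()) (λ ()) (λ ())
    2<₁ 2<₀ u'∈₁ v'∈₀ u'v' (¬edge ∘ swap)
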